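{- Let $k\ge 0$ and let $G$ be a $k$-spanner with central vertices $c_1,c_2$. Then up to an automorphism of $G$ there is a unique pair in $\Lambda_\mu(G)$, namely the pair $(H,H')$ in which: the edge $c_1c_2$ is in neither $H$ nor $H'$; at each central vertex $c_i$ there is one leg whose inner edge is in $H$ and outer edge is in $H'$, and one other leg whose inner edge is in $H'$ and outer edge is in $H$; and every remaining leg has its inner edge in neither $H$ nor $H'$ and its outer edge in $H$. In particular, $\lambda(G)=k+8$ and $\mu(G)=k+4$.
   Context: All graphs are finite, simple, undirected and loopless. $\lambda(G)=\max\{|H|+|H'| : H,H' \text{ are disjoint matchings in } G\}$, $\Lambda(G)$ is the set of ordered pairs $(H,H')$ of disjoint matchings of $G$ with $|H|+|H'|=\lambda(G)$, $\mu(G)=\max\{|H| : (H,H')\in\Lambda(G)\}$, and $\Lambda_\mu(G)$ is the set of $(H,H')\in\Lambda(G)$ with $|H|=\mu(G)$. A leg attached at a vertex $c$ is a path $c\,x\,y$ with $x,y$ new vertices; $cx$ is its inner edge and $xy$ its outer edge. For an integer $k\ge 0$, a $k$-spanner is the tree obtained from two vertices $c_1,c_2$ (the central vertices) joined by an edge, by attaching $p\ge 2$ legs at $c_1$ and $q\ge 2$ legs at $c_2$, with $p+q=k+4$ (all leg vertices distinct). -}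

module Defs where

open import Data.Nat using (ℕ; zero; suc; _+_; _≤_)
open import Data.Fin using (Fin)
open import Data.Fin.Properties using (_≟_)
open import Data.Bool using (Bool; true; false; not; if_then_else_)
open import Data.List using (List; _∷_; []; map; allFin; _++_)
open import Data.Nat.ListAction using (sum)
open import Data.Product using (_×_; _,_; Σ; ∃; proj₁; proj₂)
open import Data.Sum using (_⊎_)
open import Relation.Nullary using (¬_)
open import Relation.Nullary.Decidable using (⌊_⌋)
open import Relation.Binary.PropositionalEquality using (_≡_)

-- The k-spanner with p legs at c₁ and q legs at c₂ (concrete model).
-- Vertices: central vertices c₁ c₂; leg i at c₁ is c₁ – x₁ i – y₁ i,
-- leg j at c₂ is c₂ – x₂ j – y₂ j.

data V (p q : ℕ) : Set where
  c₁ c₂ : V p q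
  x₁ y₁ : Fin p → V p q
  x₂ y₂ : Fin q → V p q

data E (p q : ℕ) : Set where
  cc         : E p q
  in₁ out₁   : Fin p → E p q
  in₂ out₂   : Fin q → E p q

ends : ∀ {p q} → E p q → V p q × V p q
ends cc       = c₁ , c₂
ends (in₁ i)  = c₁ , x₁ i
ends (out₁ i) = x₁ i , y₁ i
ends (in₂ j)  = c₂ , x₂ j
ends (out₂ j) = x₂ j , y₂ j

edges : ∀ p q → List (E p q)
edges p q = cc ∷ map in₁ (allFin p) ++ map out₁ (allFin p)
              ++ map in₂ (allFin q) ++ map out₂ (allFin q)

Joins : ∀ {p q} → E p q → V p q → V p q → Set
Joins e u v = (ends e ≡ (u , v)) ⊎ (ends e ≡ (v , u))

Adj : ∀ {p q} → V p q → V p q → Set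
Adj u v = ∃ λ e → Joins e u v

EdgeSet : ℕ → ℕ → Set
EdgeSet p q = E p q → Bool

Share : ∀ {p q} → E p q → E p q → Set
Share e f = (proj₁ (ends e) ≡ proj₁ (ends f)) ⊎ (proj₁ (ends e) ≡ proj₂ (ends f))
          ⊎ (proj₂ (ends e) ≡ proj₁ (ends f)) ⊎ (proj₂ (ends e) ≡ proj₂ (ends f))

IsMatching : ∀ {p q} → EdgeSet p q → Set
IsMatching M = ∀ e f → M e ≡ true → M f ≡ true → ¬ (e ≡ f) → ¬ Share e f

b2n : Bool → ℕ
b2n true  = 1
b2n false = 0

size : ∀ {p q} → EdgeSet p q → ℕ
size {p} {q} M = sum (map (λ e → b2n (M e)) (edges p q))

DisjointSets : ∀ {p q} → EdgeSet p q → EdgeSet p q → Set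
DisjointSets H H' = ∀ e → H e ≡ true → H' e ≡ false

DisjMatch : ∀ {p q} → EdgeSet p q → EdgeSet p q → Set
DisjMatch H H' = IsMatching H × IsMatching H' × DisjointSets H H'

InΛ : ∀ {p q} → EdgeSet p q → EdgeSet p q → Set
InΛ {p} {q} H H' = DisjMatch H H'
  × (∀ (K K' : EdgeSet p q) → DisjMatch K K' → size K + size K' ≤ size H + size H')

InΛμ : ∀ {p q} → EdgeSet p q → EdgeSet p q → Set
InΛμ {p} {q} H H' = InΛ H H'
  × (∀ (K K' : EdgeSet p q) → InΛ K K' → size K ≤ size H)

LambdaIs : ∀ p q → ℕ → Set
LambdaIs p q n = (Σ (EdgeSet p q) λ H → Σ (EdgeSet p q) λ H' →
                     DisjMatch H H' × size H + size H' ≡ n)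
  × (∀ (K K' : EdgeSet p q) → DisjMatch K K' → size K + size K' ≤ n)

MuIs : ∀ p q → ℕ → Set
MuIs p q n = (Σ (EdgeSet p q) λ H → Σ (EdgeSet p q) λ H' →
                 InΛ H H' × size H ≡ n)
  × (∀ (K K' : EdgeSet p q) → InΛ K K' → size K ≤ n)

record Aut (p q : ℕ) : Set where
  field
    σ    : V p q → V p q
    σ⁻   : V p q → V p q
    inv₁ : ∀ v → σ (σ⁻ v) ≡ v
    inv₂ : ∀ v → σ⁻ (σ v) ≡ v
    pres : ∀ u v → Adj u v → Adj (σ u) (σ v)
    refl-adj : ∀ u v → Adj (σ u) (σ v) → Adj u v

MapsTo : ∀ {p q} → Aut p q → EdgeSet p q → EdgeSet p q → Set
MapsTo a H K = ∀ e f → Joins f (Aut.σ a (proj₁ (ends e))) (Aut.σ a (proj₂ (ends e)))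
                 → K f ≡ H e

SameSet : ∀ {p q} → EdgeSet p q → EdgeSet p q → Set
SameSet H K = ∀ e → H e ≡ K e

canonH : ∀ {p q} → Fin p → Fin p → Fin q → Fin q → EdgeSet p q
canonH a b c d cc       = false
canonH a b c d (in₁ i)  = ⌊ i ≟ a ⌋
canonH a b c d (out₁ i) = not ⌊ i ≟ a ⌋
canonH a b c d (in₂ j)  = ⌊ j ≟ c ⌋
canonH a b c d (out₂ j) = not ⌊ j ≟ c ⌋

canonH' : ∀ {p q} → Fin p → Fin p → Fin q → Fin q → EdgeSet p q
canonH' a b c d cc       = false
canonH' a b c d (in₁ i)  = ⌊ i ≟ b ⌋
canonH' a b c d (out₁ i) = ⌊ i ≟ a ⌋
canonH' a b c d (in₂ j)  = ⌊ j ≟ d ⌋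
canonH' a b c d (out₂ j) = ⌊ j ≟ c ⌋

Canonical : ∀ {p q} → EdgeSet p q → EdgeSet p q → Set
Canonical {p} {q} H H' =
  Σ (Fin p) λ a → Σ (Fin p) λ b → Σ (Fin q) λ c → Σ (Fin q) λ d →
    ¬ (a ≡ b) × ¬ (c ≡ d) × SameSet H (canonH a b c d) × SameSet H' (canonH' a b c d)

module Submission where

-- Let the spanner have p legs at c₁ and q legs at c₂.  For disjoint
-- matchings (K , K') three kinds of bottleneck bound |K| + |K'|: the star of
-- each central vertex carries at most one edge of K and one of K' (the
-- central edge c₁c₂ lies in both stars), and each outer edge lies in at most
-- one of K, K'.  Hence
--     |K| + |K'| + [c₁c₂ ∈ K] + [c₁c₂ ∈ K'] ≤ (2 + p) + (2 + q),
-- and the canonical pairs attain p + q + 4 with |H| = p + q.  So λ = k + 8,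
-- every pair of Λ avoids c₁c₂ and saturates all bottlenecks, and since a
-- matching avoiding c₁c₂ uses at most one edge per leg, μ = p + q = k + 4.
-- For a pair of Λ_μ also every leg is saturated, which pins down each edge:
-- the pair is canonical.  Two canonical pairs differ by a relabelling of
-- the legs on each side, which is an automorphism of the spanner.

open import Defs
open import Function using (_∘_)
open import Data.Nat using (ℕ; zero; suc; _+_; _≤_; z≤n; s≤s)
open import Data.Nat.Properties
  using (≤-trans; ≤-antisym; ≤-reflexive; +-mono-≤; +-monoʳ-≤; +-monoˡ-≤;
         +-cancelˡ-≤; +-cancelʳ-≤; m≤m+n; n≤0⇒n≡0; m+n≡0⇒m≡0; m+n≡0⇒n≡0;
         +-identityʳ; +-assoc; m≢1+n+m; +-0-commutativeMonoid; module ≤-Reasoning)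
open import Data.Nat.Solver using (module +-*-Solver)
open import Data.Fin using (Fin)
open import Data.Fin.Properties using (_≟_; 0≢1+n; suc-injective)
open import Data.Fin.Permutation
  using (Permutation′; _⟨$⟩ʳ_; _⟨$⟩ˡ_; inverseʳ; inverseˡ; flip; transpose; _∘ₚ_)
open import Data.Bool using (Bool; true; false; not)
open import Data.Bool.Properties using (not-involutive; ¬-not)
open import Data.List using (List; map; tabulate; allFin; _++_)
open import Data.List.Properties using (map-++; map-tabulate)
open import Data.Nat.ListAction using (sum)
open import Data.Nat.ListAction.Properties using (sum-++)
open import Algebra.Properties.CommutativeMonoid.Sum +-0-commutativeMonoid
  using (∑-distrib-+; sum-cong-≗) renaming (sum to ∑)
open import Data.Product using (_×_; _,_; Σ; proj₁; proj₂; swap)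
open import Data.Sum using (_⊎_; inj₁; inj₂)
import Data.Sum as Sum
open import Data.Empty using (⊥; ⊥-elim)
open import Relation.Nullary using (¬_; Dec; yes; no)
open import Relation.Nullary.Decidable
  using (⌊_⌋; dec-true; dec-false; isYes≗does; ⌊⌋-map′; decidable-stable)
open import Relation.Binary.PropositionalEquality

+-tight : ∀ {a b x y} → a ≤ x → b ≤ y → a + b ≡ x + y → a ≡ x × b ≡ y
+-tight {a} {b} {x} {y} a≤x b≤y eq = ≤-antisym a≤x x≤a , ≤-antisym b≤y y≤b
  where
  x≤a : x ≤ a
  x≤a = +-cancelʳ-≤ y x a (≤-trans (≤-reflexive (sym eq)) (+-monoʳ-≤ a b≤y))
  y≤b : y ≤ b
  y≤b = +-cancelˡ-≤ x y b (≤-trans (≤-reflexive (sym eq)) (+-monoˡ-≤ b a≤x))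

∑-mono-≤ : ∀ {n} {f g : Fin n → ℕ} → (∀ i → f i ≤ g i) → ∑ f ≤ ∑ g
∑-mono-≤ {zero}  _   = z≤n
∑-mono-≤ {suc n} f≤g = +-mono-≤ (f≤g Fin.zero) (∑-mono-≤ (f≤g ∘ Fin.suc))

∑-ones : ∀ n → ∑ {n} (λ _ → 1) ≡ n
∑-ones zero    = refl
∑-ones (suc n) = cong suc (∑-ones n)

∑-≤-length : ∀ {n} {f : Fin n → ℕ} → (∀ i → f i ≤ 1) → ∑ f ≤ n
∑-≤-length {n} f≤1 = ≤-trans (∑-mono-≤ f≤1) (≤-reflexive (∑-ones n))

head-and-tail : ∀ {n} {f : Fin (suc n) → ℕ} → (∀ i → f i ≤ 1) → ∑ f ≡ suc n →
                f Fin.zero ≡ 1 × ∑ (f ∘ Fin.suc) ≡ n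
head-and-tail f≤1 eq = +-tight (f≤1 Fin.zero) (∑-≤-length (f≤1 ∘ Fin.suc)) eq

∑-saturated : ∀ {n} {f : Fin n → ℕ} → (∀ i → f i ≤ 1) → ∑ f ≡ n → ∀ i → f i ≡ 1
∑-saturated {suc n} f≤1 eq Fin.zero    = proj₁ (head-and-tail f≤1 eq)
∑-saturated {suc n} f≤1 eq (Fin.suc i) =
  ∑-saturated (f≤1 ∘ Fin.suc) (proj₂ (head-and-tail f≤1 eq)) i

∑-pair-bound : ∀ {n} {f g : Fin n → ℕ} → (∀ i → f i + g i ≤ 1) → ∑ f + ∑ g ≤ n
∑-pair-bound {f = f} {g} le = ≤-trans (≤-reflexive (sym (∑-distrib-+ f g))) (∑-≤-length le)

∑-pair-saturated : ∀ {n} {f g : Fin n → ℕ} → (∀ i → f i + g i ≤ 1) → ∑ f + ∑ g ≡ n →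
                   ∀ i → f i + g i ≡ 1
∑-pair-saturated {f = f} {g} le eq = ∑-saturated le (trans (∑-distrib-+ f g) eq)

b2n-exclusive : ∀ {x y} → (x ≡ true → y ≡ false) → b2n x + b2n y ≤ 1
b2n-exclusive {true}  x→¬y rewrite x→¬y refl = ≤-reflexive refl
b2n-exclusive {false} {true}  _ = ≤-reflexive refl
b2n-exclusive {false} {false} _ = z≤n

b2n-complement : ∀ x y → b2n x + b2n y ≡ 1 → y ≡ not x
b2n-complement true  false _ = refl
b2n-complement false true  _ = refl

b2n-not : ∀ x → b2n x + b2n (not x) ≡ 1
b2n-not true  = refl
b2n-not false = refl

b2n-zero : ∀ {x} → b2n x ≡ 0 → x ≡ false
b2n-zero {false} _ = refl

conflict : ∀ {x} → x ≡ true → x ≡ false → ⊥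
conflict refl ()

#true : ∀ {n} → (Fin n → Bool) → ℕ
#true f = ∑ (λ i → b2n (f i))

AtMostOnce : ∀ {n} → (Fin n → Bool) → Set
AtMostOnce f = ∀ i j → f i ≡ true → f j ≡ true → i ≡ j

#true-none : ∀ {n} {f : Fin n → Bool} → (∀ i → f i ≡ false) → #true f ≡ 0
#true-none {zero}  _   = refl
#true-none {suc n} none = cong₂ _+_ (cong b2n (none Fin.zero)) (#true-none (none ∘ Fin.suc))

#true-unique : ∀ {n} {f : Fin n → Bool} → AtMostOnce f → #true f ≤ 1
#true-unique {zero} _ = z≤n
#true-unique {suc n} {f} uniq with f Fin.zero in f₀
... | true  = ≤-reflexive (cong suc (#true-none {n} (λ i → ¬-not (0≢1+n ∘ uniq _ _ f₀))))
... | false = #true-unique {n} (λ i j fi fj → suc-injective (uniq _ _ fi fj))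

#true-witness : ∀ {n} {f : Fin n → Bool} → #true f ≡ 1 → Σ (Fin n) λ a → f a ≡ true
#true-witness {suc n} {f} one with f Fin.zero in f₀
... | true  = Fin.zero , f₀
... | false with #true-witness one
...   | a , fa = Fin.suc a , fa

⌊⌋-true : ∀ {A : Set} (a? : Dec A) → A → ⌊ a? ⌋ ≡ true
⌊⌋-true a? a = trans (isYes≗does a?) (dec-true a? a)

⌊⌋-false : ∀ {A : Set} (a? : Dec A) → ¬ A → ⌊ a? ⌋ ≡ false
⌊⌋-false a? ¬a = trans (isYes≗does a?) (dec-false a? ¬a)

≟-sound : ∀ {n} {i a : Fin n} → ⌊ i ≟ a ⌋ ≡ true → i ≡ a
≟-sound {i = i} {a} h with i ≟ a | h
... | yes i≡a | _ = i≡a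
... | no _    | ()

#true-indicator : ∀ {n} (a : Fin n) → #true (λ i → ⌊ i ≟ a ⌋) ≡ 1
#true-indicator {suc n} Fin.zero    = cong suc (#true-none {n} (λ _ → refl))
#true-indicator {suc n} (Fin.suc a) =
  trans (sum-cong-≗ (λ i → cong b2n (⌊⌋-map′ _ _ (i ≟ a)))) (#true-indicator a)

indicator-unique : ∀ {n} {f : Fin n → Bool} {a} → (∀ i → f i ≡ ⌊ i ≟ a ⌋) → AtMostOnce f
indicator-unique f≡δ i j fi fj =
  trans (≟-sound (trans (sym (f≡δ i)) fi)) (sym (≟-sound (trans (sym (f≡δ j)) fj)))

indicator-of-unique : ∀ {n} {f : Fin n → Bool} → AtMostOnce f → #true f ≡ 1 →
                      Σ (Fin n) λ a → ∀ i → f i ≡ ⌊ i ≟ a ⌋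
indicator-of-unique {f = f} uniq one with #true-witness one
... | a , fa = a , pointwise
  where
  pointwise : ∀ i → f i ≡ ⌊ i ≟ a ⌋
  pointwise i with i ≟ a
  ... | yes refl = fa
  ... | no  i≢a  = ¬-not (λ fi → i≢a (uniq i a fi fa))

permutation-injective : ∀ {n} (π : Permutation′ n) {i j} →
                        π ⟨$⟩ʳ i ≡ π ⟨$⟩ʳ j → i ≡ j
permutation-injective π {i} {j} eq =
  trans (sym (inverseˡ π)) (trans (cong (π ⟨$⟩ˡ_) eq) (inverseˡ π))

indicator-permute : ∀ {n} (π : Permutation′ n) {a a'} → π ⟨$⟩ʳ a ≡ a' →
                    ∀ i → ⌊ π ⟨$⟩ʳ i ≟ a' ⌋ ≡ ⌊ i ≟ a ⌋
indicator-permute π {a} πa i with i ≟ a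
... | yes refl = ⌊⌋-true (_ ≟ _) πa
... | no  i≢a  =
  ⌊⌋-false (_ ≟ _) (λ πi≡a' → i≢a (permutation-injective π (trans πi≡a' (sym πa))))

transpose-hit : ∀ {n} (i j : Fin n) → transpose i j ⟨$⟩ʳ i ≡ j
transpose-hit i j rewrite dec-true (i ≟ i) refl = refl

transpose-miss : ∀ {n} {i j k : Fin n} → ¬ k ≡ i → ¬ k ≡ j → transpose i j ⟨$⟩ʳ k ≡ k
transpose-miss {i = i} {j} {k} k≢i k≢j
  rewrite dec-false (k ≟ i) k≢i | dec-false (k ≟ j) k≢j = refl

two-point-transitive : ∀ {n} {a b a' b' : Fin n} → ¬ a ≡ b → ¬ a' ≡ b' →
                       Σ (Permutation′ n) λ π → π ⟨$⟩ʳ a ≡ a' × π ⟨$⟩ʳ b ≡ b'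
two-point-transitive {a = a} {b} {a'} {b'} a≢b a'≢b' = τ ∘ₚ υ , υ-fixes-a' , transpose-hit c b'
  where
  -- first move a to a' (b goes to c), then c to b' (fixing a')
  τ = transpose a a'
  c = τ ⟨$⟩ʳ b
  υ = transpose c b'
  a'≢c : ¬ a' ≡ c
  a'≢c a'≡c = a≢b (permutation-injective τ (trans (transpose-hit a a') a'≡c))
  υ-fixes-a' : υ ⟨$⟩ʳ (τ ⟨$⟩ʳ a) ≡ a'
  υ-fixes-a' rewrite transpose-hit a a' = transpose-miss a'≢c a'≢b'

two-points : ∀ {n} → 2 ≤ n → Σ (Fin n) λ a → Σ (Fin n) λ b → ¬ a ≡ b
two-points {suc (suc n)} (s≤s (s≤s _)) = Fin.zero , Fin.suc Fin.zero , λ ()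

sum-map-++ : ∀ {A : Set} (h : A → ℕ) (xs ys : List A) →
             sum (map h (xs ++ ys)) ≡ sum (map h xs) + sum (map h ys)
sum-map-++ h xs ys = trans (cong sum (map-++ h xs ys)) (sum-++ (map h xs) (map h ys))

sum-tabulate : ∀ {A : Set} {n} (h : A → ℕ) (g : Fin n → A) →
               sum (map h (tabulate g)) ≡ ∑ (h ∘ g)
sum-tabulate {n = zero}  h g = refl
sum-tabulate {n = suc n} h g = cong (h (g Fin.zero) +_) (sum-tabulate h (g ∘ Fin.suc))

sum-family : ∀ {A : Set} {n} (h : A → ℕ) (g : Fin n → A) →
             sum (map h (map g (allFin n))) ≡ ∑ (h ∘ g)
sum-family h g = trans (cong (sum ∘ map h) (map-tabulate (λ i → i) g)) (sum-tabulate h g)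

data Side : Set where
  one two : Side

module Spanner {p q : ℕ} where

  legs : Side → ℕ
  legs one = p
  legs two = q

  inner outer : (s : Side) → Fin (legs s) → E p q
  inner one = in₁
  inner two = in₂
  outer one = out₁
  outer two = out₂

  -- The spanner is a tree rooted at c₁; every edge runs from its near end
  -- (closer to c₁) to its far end.
  near far : E p q → V p q
  near e = proj₁ (ends e)
  far  e = proj₂ (ends e)

  #inner #outer : Side → EdgeSet p q → ℕ
  #inner s M = #true (λ i → M (inner s i))
  #outer s M = #true (λ i → M (outer s i))

  on-legs : Side → EdgeSet p q → ℕ
  on-legs s M = #inner s M + #outer s M

  size-by-sides : (M : EdgeSet p q) → size M ≡ b2n (M cc) + (on-legs one M + on-legs two M)
  size-by-sides M = cong (b2n (M cc) +_) (begin
      sum (map h (I₁ ++ O₁ ++ I₂ ++ O₂))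
    ≡⟨ sum-map-++ h I₁ _ ⟩
      sum (map h I₁) + sum (map h (O₁ ++ I₂ ++ O₂))
    ≡⟨ cong (sum (map h I₁) +_) (sum-map-++ h O₁ _) ⟩
      sum (map h I₁) + (sum (map h O₁) + sum (map h (I₂ ++ O₂)))
    ≡⟨ cong (λ t → sum (map h I₁) + (sum (map h O₁) + t)) (sum-map-++ h I₂ O₂) ⟩
      sum (map h I₁) + (sum (map h O₁) + (sum (map h I₂) + sum (map h O₂)))
    ≡⟨ cong₂ (λ x y → x + (y + (sum (map h I₂) + sum (map h O₂))))
             (sum-family h in₁) (sum-family h out₁) ⟩
      #inner one M + (#outer one M + (sum (map h I₂) + sum (map h O₂)))
    ≡⟨ cong₂ (λ x y → #inner one M + (#outer one M + (x + y)))
             (sum-family h in₂) (sum-family h out₂) ⟩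
      #inner one M + (#outer one M + (#inner two M + #outer two M))
    ≡⟨ sym (+-assoc (#inner one M) _ _) ⟩
      on-legs one M + on-legs two M
    ∎)
    where
    open ≡-Reasoning
    h : E p q → ℕ
    h e = b2n (M e)
    I₁ O₁ : List (E p q)
    I₁ = map in₁ (allFin p)
    O₁ = map out₁ (allFin p)
    I₂ O₂ : List (E p q)
    I₂ = map in₂ (allFin q)
    O₂ = map out₂ (allFin q)

  size-avoiding-cc : ∀ {M} → M cc ≡ false → size M ≡ on-legs one M + on-legs two M
  size-avoiding-cc {M} mc =
    trans (size-by-sides M) (cong (λ c → b2n c + (on-legs one M + on-legs two M)) mc)

  Meet : E p q → E p q → Set
  Meet e f = ¬ e ≡ f × Share e f

  centre-meets-inner : ∀ s i → Meet cc (inner s i)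
  centre-meets-inner one i = (λ ()) , inj₁ refl
  centre-meets-inner two i = (λ ()) , inj₂ (inj₂ (inj₁ refl))

  inners-meet : ∀ s {i j} → ¬ i ≡ j → Meet (inner s i) (inner s j)
  inners-meet one i≢j = (λ { refl → i≢j refl }) , inj₁ refl
  inners-meet two i≢j = (λ { refl → i≢j refl }) , inj₁ refl

  inner-meets-outer : ∀ s i → Meet (inner s i) (outer s i)
  inner-meets-outer one i = (λ ()) , inj₂ (inj₂ (inj₁ refl))
  inner-meets-outer two i = (λ ()) , inj₂ (inj₂ (inj₁ refl))

  exclusive : ∀ {M e f} → IsMatching M → Meet e f → M e ≡ true → M f ≡ false
  exclusive mM (e≢f , shared) me = ¬-not (λ mf → mM _ _ me mf e≢f shared)

  record LocalAt (s : Side) (M : EdgeSet p q) : Set where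
    field
      centre-free : M cc ≡ true → ∀ i → M (inner s i) ≡ false
      one-inner   : AtMostOnce (λ i → M (inner s i))
      leg-free    : ∀ i → M (inner s i) ≡ true → M (outer s i) ≡ false
  open LocalAt

  matching⇒local : ∀ {M} → IsMatching M → ∀ s → LocalAt s M
  matching⇒local mM s = record
    { centre-free = λ mc i → exclusive mM (centre-meets-inner s i) mc
    ; one-inner   = λ i j mi mj → decidable-stable (i ≟ j)
                      (λ i≢j → conflict mj (exclusive mM (inners-meet s i≢j) mi))
    ; leg-free    = λ i → exclusive mM (inner-meets-outer s i)
    }

  data Incident : V p q → E p q → Set where
    c₁-cc   : Incident c₁ cc
    c₂-cc   : Incident c₂ cc
    c₁-in₁  : ∀ i → Incident c₁ (in₁ i)
    x₁-in₁  : ∀ i → Incident (x₁ i) (in₁ i)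
    x₁-out₁ : ∀ i → Incident (x₁ i) (out₁ i)
    y₁-out₁ : ∀ i → Incident (y₁ i) (out₁ i)
    c₂-in₂  : ∀ j → Incident c₂ (in₂ j)
    x₂-in₂  : ∀ j → Incident (x₂ j) (in₂ j)
    x₂-out₂ : ∀ j → Incident (x₂ j) (out₂ j)
    y₂-out₂ : ∀ j → Incident (y₂ j) (out₂ j)

  incident : ∀ {v} e → v ≡ near e ⊎ v ≡ far e → Incident v e
  incident cc       (inj₁ refl) = c₁-cc
  incident cc       (inj₂ refl) = c₂-cc
  incident (in₁ i)  (inj₁ refl) = c₁-in₁ i
  incident (in₁ i)  (inj₂ refl) = x₁-in₁ i
  incident (out₁ i) (inj₁ refl) = x₁-out₁ i
  incident (out₁ i) (inj₂ refl) = y₁-out₁ i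
  incident (in₂ j)  (inj₁ refl) = c₂-in₂ j
  incident (in₂ j)  (inj₂ refl) = x₂-in₂ j
  incident (out₂ j) (inj₁ refl) = x₂-out₂ j
  incident (out₂ j) (inj₂ refl) = y₂-out₂ j

  common-vertex : ∀ e f → Share e f → Σ (V p q) λ v → Incident v e × Incident v f
  common-vertex e f (inj₁ eq)               = near e , incident e (inj₁ refl) , incident f (inj₁ eq)
  common-vertex e f (inj₂ (inj₁ eq))        = near e , incident e (inj₁ refl) , incident f (inj₂ eq)
  common-vertex e f (inj₂ (inj₂ (inj₁ eq))) = far e , incident e (inj₂ refl) , incident f (inj₁ eq)
  common-vertex e f (inj₂ (inj₂ (inj₂ eq))) = far e , incident e (inj₂ refl) , incident f (inj₂ eq)

  local-star : ∀ {M v e f} → (∀ s → LocalAt s M) → Incident v e → Incident v f →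
               M e ≡ true → M f ≡ true → e ≡ f
  local-star L c₁-cc       c₁-cc        _  _  = refl
  local-star L c₁-cc       (c₁-in₁ i)   me mf = ⊥-elim (conflict mf (centre-free (L one) me i))
  local-star L (c₁-in₁ i)  c₁-cc        me mf = ⊥-elim (conflict me (centre-free (L one) mf i))
  local-star L (c₁-in₁ i)  (c₁-in₁ j)   me mf = cong in₁ (one-inner (L one) i j me mf)
  local-star L c₂-cc       c₂-cc        _  _  = refl
  local-star L c₂-cc       (c₂-in₂ j)   me mf = ⊥-elim (conflict mf (centre-free (L two) me j))
  local-star L (c₂-in₂ j)  c₂-cc        me mf = ⊥-elim (conflict me (centre-free (L two) mf j))
  local-star L (c₂-in₂ i)  (c₂-in₂ j)   me mf = cong in₂ (one-inner (L two) i j me mf)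
  local-star L (x₁-in₁ i)  (x₁-in₁ _)   _  _  = refl
  local-star L (x₁-in₁ i)  (x₁-out₁ _)  me mf = ⊥-elim (conflict mf (leg-free (L one) i me))
  local-star L (x₁-out₁ i) (x₁-in₁ _)   me mf = ⊥-elim (conflict me (leg-free (L one) i mf))
  local-star L (x₁-out₁ i) (x₁-out₁ _)  _  _  = refl
  local-star L (y₁-out₁ i) (y₁-out₁ _)  _  _  = refl
  local-star L (x₂-in₂ j)  (x₂-in₂ _)   _  _  = refl
  local-star L (x₂-in₂ j)  (x₂-out₂ _)  me mf = ⊥-elim (conflict mf (leg-free (L two) j me))
  local-star L (x₂-out₂ j) (x₂-in₂ _)   me mf = ⊥-elim (conflict me (leg-free (L two) j mf))
  local-star L (x₂-out₂ j) (x₂-out₂ _)  _  _  = refl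
  local-star L (y₂-out₂ j) (y₂-out₂ _)  _  _  = refl

  local⇒matching : ∀ {M} → (∀ s → LocalAt s M) → IsMatching M
  local⇒matching L e f me mf e≢f shared with common-vertex e f shared
  ... | _ , at-e , at-f = e≢f (local-star L at-e at-f me mf)

  star : Side → EdgeSet p q → ℕ
  star s M = b2n (M cc) + #inner s M

  star-bound : ∀ {s M} → LocalAt s M → star s M ≤ 1
  star-bound {M = M} L with M cc in mc
  ... | true  = ≤-reflexive (cong suc (#true-none (centre-free L mc)))
  ... | false = #true-unique (one-inner L)

  legs-bound : ∀ {s M} → LocalAt s M → on-legs s M ≤ legs s
  legs-bound L = ∑-pair-bound (λ i → b2n-exclusive (leg-free L i))

  outer-bound : ∀ {s K K'} → DisjointSets K K' → #outer s K + #outer s K' ≤ legs s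
  outer-bound {s} disj = ∑-pair-bound (λ i → b2n-exclusive (disj (outer s i)))

  load : Side → EdgeSet p q → EdgeSet p q → ℕ
  load s K K' = (star s K + star s K') + (#outer s K + #outer s K')

  load-bound : ∀ {K K'} → DisjMatch K K' → ∀ s → load s K K' ≤ 2 + legs s
  load-bound (mK , mK' , disj) s =
    +-mono-≤ (+-mono-≤ (star-bound (matching⇒local mK s)) (star-bound (matching⇒local mK' s)))
             (outer-bound disj)

  -- The loads of the two sides count every edge once, except c₁c₂ which is
  -- counted in both stars.
  load-total : ∀ K K' →
    size K + size K' + (b2n (K cc) + b2n (K' cc)) ≡ load one K K' + load two K K'
  load-total K K' rewrite size-by-sides K | size-by-sides K' =
    rearrange (b2n (K cc)) (b2n (K' cc)) (#inner one K) (#outer one K) (#inner two K) (#outer two K)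
              (#inner one K') (#outer one K') (#inner two K') (#outer two K')
    where
    open +-*-Solver
    rearrange : ∀ c c' a b x y a' b' x' y' →
      c + ((a + b) + (x + y)) + (c' + ((a' + b') + (x' + y'))) + (c + c')
      ≡ ((c + a) + (c' + a')) + (b + b') + (((c + x) + (c' + x')) + (y + y'))
    rearrange = solve 10 (λ c c' a b x y a' b' x' y' →
      c :+ ((a :+ b) :+ (x :+ y)) :+ (c' :+ ((a' :+ b') :+ (x' :+ y'))) :+ (c :+ c')
      := ((c :+ a) :+ (c' :+ a')) :+ (b :+ b') :+ (((c :+ x) :+ (c' :+ x')) :+ (y :+ y'))) refl

  sides-total : (2 + p) + (2 + q) ≡ p + q + 4
  sides-total = solve 2 (λ p q → (con 2 :+ p) :+ (con 2 :+ q) := p :+ q :+ con 4) refl p q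
    where open +-*-Solver

  pair-bound : ∀ {K K'} → DisjMatch K K' →
    size K + size K' + (b2n (K cc) + b2n (K' cc)) ≤ p + q + 4
  pair-bound {K} {K'} dm = begin
    size K + size K' + (b2n (K cc) + b2n (K' cc)) ≡⟨ load-total K K' ⟩
    load one K K' + load two K K'                 ≤⟨ +-mono-≤ (load-bound dm one)
                                                                (load-bound dm two) ⟩
    (2 + p) + (2 + q)                             ≡⟨ sides-total ⟩
    p + q + 4                                     ∎
    where open ≤-Reasoning

  λ-bound : ∀ {K K'} → DisjMatch K K' → size K + size K' ≤ p + q + 4
  λ-bound dm = ≤-trans (m≤m+n _ _) (pair-bound dm)

  record Shape (s : Side) (H H' : EdgeSet p q) : Set where
    field
      a b      : Fin (legs s)
      a≢b      : ¬ a ≡ b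
      H-inner  : ∀ i → H  (inner s i) ≡ ⌊ i ≟ a ⌋
      H-outer  : ∀ i → H  (outer s i) ≡ not ⌊ i ≟ a ⌋
      H'-inner : ∀ i → H' (inner s i) ≡ ⌊ i ≟ b ⌋
      H'-outer : ∀ i → H' (outer s i) ≡ ⌊ i ≟ a ⌋
  open Shape

  record Sides (H H' : EdgeSet p q) : Set where
    field
      H-cc  : H  cc ≡ false
      H'-cc : H' cc ≡ false
      shape : ∀ s → Shape s H H'
  open Sides

  canonical⇒sides : ∀ {H H'} → Canonical H H' → Sides H H'
  canonical⇒sides (a , b , c , d , a≢b , c≢d , sH , sH') = record
    { H-cc  = sH cc
    ; H'-cc = sH' cc
    ; shape = λ { one → record { a = a ; b = b ; a≢b = a≢b
                               ; H-inner = sH ∘ in₁ ; H-outer = sH ∘ out₁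
                               ; H'-inner = sH' ∘ in₁ ; H'-outer = sH' ∘ out₁ }
                ; two → record { a = c ; b = d ; a≢b = c≢d
                               ; H-inner = sH ∘ in₂ ; H-outer = sH ∘ out₂
                               ; H'-inner = sH' ∘ in₂ ; H'-outer = sH' ∘ out₂ } }
    }

  sides⇒canonical : ∀ {H H'} → Sides H H' → Canonical H H'
  sides⇒canonical {H} {H'} S = a S₁ , b S₁ , a S₂ , b S₂ , a≢b S₁ , a≢b S₂ , onH , onH'
    where
    S₁ : Shape one H H'
    S₁ = shape S one
    S₂ : Shape two H H'
    S₂ = shape S two
    onH : SameSet H (canonH (a S₁) (b S₁) (a S₂) (b S₂))
    onH cc       = H-cc S
    onH (in₁ i)  = H-inner S₁ i
    onH (out₁ i) = H-outer S₁ i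
    onH (in₂ j)  = H-inner S₂ j
    onH (out₂ j) = H-outer S₂ j
    onH' : SameSet H' (canonH' (a S₁) (b S₁) (a S₂) (b S₂))
    onH' cc       = H'-cc S
    onH' (in₁ i)  = H'-inner S₁ i
    onH' (out₁ i) = H'-outer S₁ i
    onH' (in₂ j)  = H'-inner S₂ j
    onH' (out₂ j) = H'-outer S₂ j

  canonical-exists : 2 ≤ p → 2 ≤ q →
                     Σ (EdgeSet p q) λ H → Σ (EdgeSet p q) λ H' → Canonical H H'
  canonical-exists 2≤p 2≤q with two-points 2≤p | two-points 2≤q
  ... | a , b , a≢b | c , d , c≢d =
    canonH a b c d , canonH' a b c d , a , b , c , d , a≢b , c≢d , (λ _ → refl) , (λ _ → refl)

  shape-local-H : ∀ {s H H'} → Shape s H H' → H cc ≡ false → LocalAt s H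
  shape-local-H S hc = record
    { centre-free = λ hc' → ⊥-elim (conflict hc' hc)
    ; one-inner   = indicator-unique (H-inner S)
    ; leg-free    = λ i hi → trans (H-outer S i) (cong not (trans (sym (H-inner S i)) hi))
    }

  shape-local-H' : ∀ {s H H'} → Shape s H H' → H' cc ≡ false → LocalAt s H'
  shape-local-H' S hc = record
    { centre-free = λ hc' → ⊥-elim (conflict hc' hc)
    ; one-inner   = indicator-unique (H'-inner S)
    ; leg-free    = λ i hi → trans (H'-outer S i) (⌊⌋-false (i ≟ a S) (λ i≡a →
                      a≢b S (trans (sym i≡a) (≟-sound (trans (sym (H'-inner S i)) hi)))))
    }

  shape-disjoint-inner : ∀ {s H H'} (S : Shape s H H') i →
                         H (inner s i) ≡ true → H' (inner s i) ≡ false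
  shape-disjoint-inner S i hi with ≟-sound (trans (sym (H-inner S i)) hi)
  ... | refl = trans (H'-inner S i) (⌊⌋-false (_ ≟ _) (a≢b S))

  shape-disjoint-outer : ∀ {s H H'} (S : Shape s H H') i →
                         H (outer s i) ≡ true → H' (outer s i) ≡ false
  shape-disjoint-outer S i hi =
    trans (H'-outer S i) (trans (sym (not-involutive _)) (cong not (trans (sym (H-outer S i)) hi)))

  sides-disjoint : ∀ {H H'} → Sides H H' → DisjointSets H H'
  sides-disjoint S cc       h = ⊥-elim (conflict h (H-cc S))
  sides-disjoint S (in₁ i)  h = shape-disjoint-inner (shape S one) i h
  sides-disjoint S (out₁ i) h = shape-disjoint-outer (shape S one) i h
  sides-disjoint S (in₂ j)  h = shape-disjoint-inner (shape S two) j h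
  sides-disjoint S (out₂ j) h = shape-disjoint-outer (shape S two) j h

  shape-legs-H : ∀ {s H H'} → Shape s H H' → on-legs s H ≡ legs s
  shape-legs-H {s} {H} S = begin
    #inner s H + #outer s H                            ≡⟨ sym (∑-distrib-+ inner-H outer-H) ⟩
    ∑ (λ i → inner-H i + outer-H i)                    ≡⟨ sum-cong-≗ one-per-leg ⟩
    ∑ {legs s} (λ _ → 1)                               ≡⟨ ∑-ones (legs s) ⟩
    legs s                                             ∎
    where
    open ≡-Reasoning
    inner-H outer-H : Fin (legs s) → ℕ
    inner-H i = b2n (H (inner s i))
    outer-H i = b2n (H (outer s i))
    one-per-leg : ∀ i → inner-H i + outer-H i ≡ 1
    one-per-leg i = trans (cong₂ (λ x y → b2n x + b2n y) (H-inner S i) (H-outer S i))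
                          (b2n-not ⌊ i ≟ a S ⌋)

  shape-legs-H' : ∀ {s H H'} → Shape s H H' → on-legs s H' ≡ 2
  shape-legs-H' S = cong₂ _+_
    (trans (sum-cong-≗ (cong b2n ∘ H'-inner S)) (#true-indicator (b S)))
    (trans (sum-cong-≗ (cong b2n ∘ H'-outer S)) (#true-indicator (a S)))

  canonical-size-H : ∀ {H H'} → Canonical H H' → size H ≡ p + q
  canonical-size-H {H} {H'} can =
    trans (size-avoiding-cc (H-cc S))
          (cong₂ _+_ (shape-legs-H (shape S one)) (shape-legs-H (shape S two)))
    where
    S : Sides H H'
    S = canonical⇒sides can

  canonical-size-H' : ∀ {H H'} → Canonical H H' → size H' ≡ 4
  canonical-size-H' {H} {H'} can =
    trans (size-avoiding-cc (H'-cc S))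
          (cong₂ _+_ (shape-legs-H' (shape S one)) (shape-legs-H' (shape S two)))
    where
    S : Sides H H'
    S = canonical⇒sides can

  canonical-disjmatch : ∀ {H H'} → Canonical H H' → DisjMatch H H'
  canonical-disjmatch {H} {H'} can =
      local⇒matching (λ s → shape-local-H (shape S s) (H-cc S))
    , local⇒matching (λ s → shape-local-H' (shape S s) (H'-cc S))
    , sides-disjoint S
    where
    S : Sides H H'
    S = canonical⇒sides can

  canonical-total : ∀ {H H'} → Canonical H H' → size H + size H' ≡ p + q + 4
  canonical-total can = cong₂ _+_ (canonical-size-H can) (canonical-size-H' can)

  canonical-Λ : ∀ {H H'} → Canonical H H' → InΛ H H'
  canonical-Λ can = canonical-disjmatch can ,
    λ K K' dm → ≤-trans (λ-bound dm) (≤-reflexive (sym (canonical-total can)))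

  -- Extremal pairs.  The lemmas take some canonical pair (H₀ , H₀') as a
  -- witness that the bound p + q + 4 is attained.
  -- A pair of Λ avoids c₁c₂ and saturates the bound at both sides.
  Λ-saturation : ∀ {H₀ H₀' K K'} → Canonical H₀ H₀' → InΛ K K' →
    K cc ≡ false × K' cc ≡ false × (∀ s → load s K K' ≡ 2 + legs s)
  Λ-saturation {H₀} {H₀'} {K} {K'} can₀ (dm , maximal) =
    b2n-zero (m+n≡0⇒m≡0 _ unused) , b2n-zero (m+n≡0⇒n≡0 _ unused) , per-side
    where
    T x : ℕ
    T = size K + size K'
    x = b2n (K cc) + b2n (K' cc)
    attained : p + q + 4 ≤ T
    attained = ≤-trans (≤-reflexive (sym (canonical-total can₀)))
                       (maximal H₀ H₀' (canonical-disjmatch can₀))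
    unused : x ≡ 0
    unused = n≤0⇒n≡0 (+-cancelˡ-≤ T x 0
      (≤-trans (pair-bound dm) (≤-trans attained (≤-reflexive (sym (+-identityʳ T))))))
    total : load one K K' + load two K K' ≡ (2 + p) + (2 + q)
    total = begin
      load one K K' + load two K K' ≡⟨ sym (load-total K K') ⟩
      T + x                         ≡⟨ ≤-antisym (pair-bound dm) (≤-trans attained (m≤m+n T x)) ⟩
      p + q + 4                     ≡⟨ sym sides-total ⟩
      (2 + p) + (2 + q)             ∎
      where open ≡-Reasoning
    tight : load one K K' ≡ 2 + p × load two K K' ≡ 2 + q
    tight = +-tight (load-bound dm one) (load-bound dm two) total
    per-side : ∀ s → load s K K' ≡ 2 + legs s
    per-side one = proj₁ tight
    per-side two = proj₂ tight

  -- μ ≤ p + q: a matching avoiding c₁c₂ has at most one edge per leg.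
  μ-bound : ∀ {H₀ H₀' K K'} → Canonical H₀ H₀' → InΛ K K' → size K ≤ p + q
  μ-bound {K = K} can₀ Λ@((mK , _) , _) = begin
    size K                          ≡⟨ size-avoiding-cc (proj₁ (Λ-saturation can₀ Λ)) ⟩
    on-legs one K + on-legs two K   ≤⟨ +-mono-≤ (legs-bound (L one)) (legs-bound (L two)) ⟩
    p + q                           ∎
    where
    open ≤-Reasoning
    L : ∀ s → LocalAt s K
    L = matching⇒local mK

  canonical⇒Λμ : ∀ {H H'} → Canonical H H' → InΛμ H H'
  canonical⇒Λμ can = canonical-Λ can ,
    λ K K' Λ → ≤-trans (μ-bound can Λ) (≤-reflexive (sym (canonical-size-H can)))

  Λμ-legs : ∀ {H₀ H₀' H H'} → Canonical H₀ H₀' → InΛμ H H' →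
    ∀ s → on-legs s H ≡ legs s
  Λμ-legs {H₀} {H₀'} {H} can₀ (Λ@((mH , _) , _) , maximal) = per-side
    where
    L : ∀ s → LocalAt s H
    L = matching⇒local mH
    size-H : size H ≡ p + q
    size-H = ≤-antisym (μ-bound can₀ Λ)
      (≤-trans (≤-reflexive (sym (canonical-size-H can₀))) (maximal H₀ H₀' (canonical-Λ can₀)))
    legs-sum : on-legs one H + on-legs two H ≡ p + q
    legs-sum = trans (sym (size-avoiding-cc (proj₁ (Λ-saturation can₀ Λ)))) size-H
    tight : on-legs one H ≡ p × on-legs two H ≡ q
    tight = +-tight (legs-bound (L one)) (legs-bound (L two)) legs-sum
    per-side : ∀ s → on-legs s H ≡ legs s
    per-side one = proj₁ tight
    per-side two = proj₂ tight

  saturated-shape : ∀ {s H H'} → DisjMatch H H' → H cc ≡ false → H' cc ≡ false →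
    load s H H' ≡ 2 + legs s → on-legs s H ≡ legs s → Shape s H H'
  saturated-shape {s} {H} {H'} (mH , mH' , disj) hc hc' loaded legs-full = record
    { a        = a₀
    ; b        = b₀
    ; a≢b      = λ a≡b → conflict (trans (H'-in a₀) (⌊⌋-true (a₀ ≟ b₀) a≡b))
                                   (disj _ (trans (H-in a₀) (⌊⌋-true (a₀ ≟ a₀) refl)))
    ; H-inner  = H-in
    ; H-outer  = H-out
    ; H'-inner = H'-in
    ; H'-outer = λ i → trans (b2n-complement _ _ (one-per-outer i))
                         (trans (cong not (H-out i)) (not-involutive _))
    }
    where
    LH : LocalAt s H
    LH = matching⇒local mH s
    LH' : LocalAt s H'
    LH' = matching⇒local mH' s
    stars-and-outers : star s H + star s H' ≡ 2 × #outer s H + #outer s H' ≡ legs s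
    stars-and-outers =
      +-tight (+-mono-≤ (star-bound LH) (star-bound LH')) (outer-bound disj) loaded
    stars : star s H ≡ 1 × star s H' ≡ 1
    stars = +-tight (star-bound LH) (star-bound LH') (proj₁ stars-and-outers)
    inner-H : #inner s H ≡ 1
    inner-H = trans (cong (λ c → b2n c + #inner s H) (sym hc)) (proj₁ stars)
    inner-H' : #inner s H' ≡ 1
    inner-H' = trans (cong (λ c → b2n c + #inner s H') (sym hc')) (proj₂ stars)
    A : Σ (Fin (legs s)) λ a → ∀ i → H (inner s i) ≡ ⌊ i ≟ a ⌋
    A = indicator-of-unique (one-inner LH) inner-H
    B : Σ (Fin (legs s)) λ b → ∀ i → H' (inner s i) ≡ ⌊ i ≟ b ⌋
    B = indicator-of-unique (one-inner LH') inner-H'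
    a₀ b₀ : Fin (legs s)
    a₀ = proj₁ A
    b₀ = proj₁ B
    H-in : ∀ i → H (inner s i) ≡ ⌊ i ≟ a₀ ⌋
    H-in = proj₂ A
    H'-in : ∀ i → H' (inner s i) ≡ ⌊ i ≟ b₀ ⌋
    H'-in = proj₂ B
    one-per-leg : ∀ i → b2n (H (inner s i)) + b2n (H (outer s i)) ≡ 1
    one-per-leg = ∑-pair-saturated (λ i → b2n-exclusive (leg-free LH i)) legs-full
    one-per-outer : ∀ i → b2n (H (outer s i)) + b2n (H' (outer s i)) ≡ 1
    one-per-outer =
      ∑-pair-saturated (λ i → b2n-exclusive (disj (outer s i))) (proj₂ stars-and-outers)
    H-out : ∀ i → H (outer s i) ≡ not ⌊ i ≟ a₀ ⌋
    H-out i = trans (b2n-complement _ _ (one-per-leg i)) (cong not (H-in i))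

  Λμ⇒canonical : ∀ {H₀ H₀' H H'} → Canonical H₀ H₀' → InΛμ H H' → Canonical H H'
  Λμ⇒canonical can₀ Λμ@(Λ@(dm , _) , _) with Λ-saturation can₀ Λ
  ... | hc , hc' , loaded = sides⇒canonical (record
    { H-cc  = hc
    ; H'-cc = hc'
    ; shape = λ s → saturated-shape dm hc hc' (loaded s) (Λμ-legs can₀ Λμ s)
    })

  -- Automorphisms relabelling the legs.  The far end determines the edge ...
  edge-to : V p q → E p q
  edge-to c₁     = cc
  edge-to c₂     = cc
  edge-to (x₁ i) = in₁ i
  edge-to (y₁ i) = out₁ i
  edge-to (x₂ j) = in₂ j
  edge-to (y₂ j) = out₂ j

  edge-to-far : ∀ e → edge-to (far e) ≡ e
  edge-to-far cc       = refl
  edge-to-far (in₁ i)  = refl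
  edge-to-far (out₁ i) = refl
  edge-to-far (in₂ j)  = refl
  edge-to-far (out₂ j) = refl

  -- ... and every edge goes one level deeper in the tree, so no edge has
  -- the ends of another in reverse order.
  depth : V p q → ℕ
  depth c₁     = 0
  depth c₂     = 1
  depth (x₁ _) = 1
  depth (y₁ _) = 2
  depth (x₂ _) = 2
  depth (y₂ _) = 3

  depth-far : ∀ e → depth (far e) ≡ suc (depth (near e))
  depth-far cc       = refl
  depth-far (in₁ i)  = refl
  depth-far (out₁ i) = refl
  depth-far (in₂ j)  = refl
  depth-far (out₂ j) = refl

  no-reversal : ∀ f g → ends f ≡ swap (ends g) → ⊥
  no-reversal f g eq = m≢1+n+m (depth (far f)) (begin
    depth (far f)               ≡⟨ depth-far f ⟩
    suc (depth (near f))        ≡⟨ cong (suc ∘ depth ∘ proj₁) eq ⟩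
    suc (depth (far g))         ≡⟨ cong suc (depth-far g) ⟩
    suc (suc (depth (near g)))  ≡⟨ cong (suc ∘ suc ∘ depth ∘ proj₂) (sym eq) ⟩
    suc (suc (depth (far f)))   ∎)
    where open ≡-Reasoning

  joins-unique : ∀ {f g u v} → Joins f u v → ends g ≡ (u , v) → f ≡ g
  joins-unique {f} {g} (inj₁ eq) eq' = begin
    f                ≡⟨ sym (edge-to-far f) ⟩
    edge-to (far f)  ≡⟨ cong (edge-to ∘ proj₂) (trans eq (sym eq')) ⟩
    edge-to (far g)  ≡⟨ edge-to-far g ⟩
    g                ∎
    where open ≡-Reasoning
  joins-unique {f} {g} (inj₂ eq) eq' = ⊥-elim (no-reversal f g (trans eq (cong swap (sym eq'))))

  Relabelling : Set
  Relabelling = (s : Side) → Permutation′ (legs s)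

  relabelV : Relabelling → V p q → V p q
  relabelV τ c₁     = c₁
  relabelV τ c₂     = c₂
  relabelV τ (x₁ i) = x₁ (τ one ⟨$⟩ʳ i)
  relabelV τ (y₁ i) = y₁ (τ one ⟨$⟩ʳ i)
  relabelV τ (x₂ j) = x₂ (τ two ⟨$⟩ʳ j)
  relabelV τ (y₂ j) = y₂ (τ two ⟨$⟩ʳ j)

  relabelE : Relabelling → E p q → E p q
  relabelE τ cc       = cc
  relabelE τ (in₁ i)  = in₁ (τ one ⟨$⟩ʳ i)
  relabelE τ (out₁ i) = out₁ (τ one ⟨$⟩ʳ i)
  relabelE τ (in₂ j)  = in₂ (τ two ⟨$⟩ʳ j)
  relabelE τ (out₂ j) = out₂ (τ two ⟨$⟩ʳ j)

  relabel-ends : ∀ τ e → ends (relabelE τ e) ≡ (relabelV τ (near e) , relabelV τ (far e))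
  relabel-ends τ cc       = refl
  relabel-ends τ (in₁ i)  = refl
  relabel-ends τ (out₁ i) = refl
  relabel-ends τ (in₂ j)  = refl
  relabel-ends τ (out₂ j) = refl

  relabel-joins : ∀ τ {e u v} → Joins e u v → Joins (relabelE τ e) (relabelV τ u) (relabelV τ v)
  relabel-joins τ {e} = Sum.map moved moved
    where
    both : V p q × V p q → V p q × V p q
    both w = relabelV τ (proj₁ w) , relabelV τ (proj₂ w)
    moved : ∀ {w} → ends e ≡ w → ends (relabelE τ e) ≡ both w
    moved eq = trans (relabel-ends τ e) (cong both eq)

  relabel-cancel : ∀ {τ υ : Relabelling} → (∀ s i → τ s ⟨$⟩ʳ (υ s ⟨$⟩ʳ i) ≡ i) →
                   ∀ v → relabelV τ (relabelV υ v) ≡ v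
  relabel-cancel τυ c₁     = refl
  relabel-cancel τυ c₂     = refl
  relabel-cancel τυ (x₁ i) = cong x₁ (τυ one i)
  relabel-cancel τυ (y₁ i) = cong y₁ (τυ one i)
  relabel-cancel τυ (x₂ j) = cong x₂ (τυ two j)
  relabel-cancel τυ (y₂ j) = cong y₂ (τυ two j)

  relabel-aut : Relabelling → Aut p q
  relabel-aut τ = record
    { σ        = relabelV τ
    ; σ⁻       = relabelV τ⁻
    ; inv₁     = relabel-cancel (λ s _ → inverseʳ (τ s))
    ; inv₂     = back
    ; pres     = λ u v (e , joins) → relabelE τ e , relabel-joins τ joins
    ; refl-adj = λ u v (e , joins) →
                   subst₂ Adj (back u) (back v) (relabelE τ⁻ e , relabel-joins τ⁻ joins)
    }
    where
    τ⁻ : Relabelling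
    τ⁻ s = flip (τ s)
    back : ∀ v → relabelV τ⁻ (relabelV τ v) ≡ v
    back = relabel-cancel (λ s _ → inverseˡ (τ s))

  relabel-maps : ∀ τ {H K} → (∀ e → K (relabelE τ e) ≡ H e) → MapsTo (relabel-aut τ) H K
  relabel-maps τ {K = K} agree e f joins =
    trans (cong K (joins-unique joins (relabel-ends τ e))) (agree e)

  canonical-aut : ∀ {H H' K K'} → Canonical H H' → Canonical K K' →
    Σ (Aut p q) λ α → MapsTo α H K × MapsTo α H' K'
  canonical-aut {H} {H'} {K} {K'} canH canK =
    relabel-aut τ , relabel-maps τ agree , relabel-maps τ agree'
    where
    SH : Sides H H'
    SH = canonical⇒sides canH
    SK : Sides K K'
    SK = canonical⇒sides canK
    moves : ∀ s → Σ (Permutation′ (legs s)) λ π →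
              π ⟨$⟩ʳ a (shape SH s) ≡ a (shape SK s) × π ⟨$⟩ʳ b (shape SH s) ≡ b (shape SK s)
    moves s = two-point-transitive (a≢b (shape SH s)) (a≢b (shape SK s))
    τ : Relabelling
    τ s = proj₁ (moves s)
    carry-a : ∀ s i → ⌊ τ s ⟨$⟩ʳ i ≟ a (shape SK s) ⌋ ≡ ⌊ i ≟ a (shape SH s) ⌋
    carry-a s = indicator-permute (τ s) (proj₁ (proj₂ (moves s)))
    carry-b : ∀ s i → ⌊ τ s ⟨$⟩ʳ i ≟ b (shape SK s) ⌋ ≡ ⌊ i ≟ b (shape SH s) ⌋
    carry-b s = indicator-permute (τ s) (proj₂ (proj₂ (moves s)))
    inner-K : ∀ s i → K (inner s (τ s ⟨$⟩ʳ i)) ≡ H (inner s i)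
    inner-K s i = trans (H-inner (shape SK s) _) (trans (carry-a s i) (sym (H-inner (shape SH s) i)))
    outer-K : ∀ s i → K (outer s (τ s ⟨$⟩ʳ i)) ≡ H (outer s i)
    outer-K s i =
      trans (H-outer (shape SK s) _) (trans (cong not (carry-a s i)) (sym (H-outer (shape SH s) i)))
    inner-K' : ∀ s i → K' (inner s (τ s ⟨$⟩ʳ i)) ≡ H' (inner s i)
    inner-K' s i = trans (H'-inner (shape SK s) _) (trans (carry-b s i) (sym (H'-inner (shape SH s) i)))
    outer-K' : ∀ s i → K' (outer s (τ s ⟨$⟩ʳ i)) ≡ H' (outer s i)
    outer-K' s i = trans (H'-outer (shape SK s) _) (trans (carry-a s i) (sym (H'-outer (shape SH s) i)))
    agree : ∀ e → K (relabelE τ e) ≡ H e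
    agree cc       = trans (H-cc SK) (sym (H-cc SH))
    agree (in₁ i)  = inner-K one i
    agree (out₁ i) = outer-K one i
    agree (in₂ j)  = inner-K two j
    agree (out₂ j) = outer-K two j
    agree' : ∀ e → K' (relabelE τ e) ≡ H' e
    agree' cc       = trans (H'-cc SK) (sym (H'-cc SH))
    agree' (in₁ i)  = inner-K' one i
    agree' (out₁ i) = outer-K' one i
    agree' (in₂ j)  = inner-K' two j
    agree' (out₂ j) = outer-K' two j

  λ-value : ∀ {H₀ H₀'} → Canonical H₀ H₀' → LambdaIs p q (p + q + 4)
  λ-value can₀ = (_ , _ , canonical-disjmatch can₀ , canonical-total can₀) , λ K K' → λ-bound

  μ-value : ∀ {H₀ H₀'} → Canonical H₀ H₀' → MuIs p q (p + q)
  μ-value can₀ = (_ , _ , canonical-Λ can₀ , canonical-size-H can₀) , λ K K' → μ-bound can₀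

lemma3p3 : (k p q : ℕ) → 2 ≤ p → 2 ≤ q → p + q ≡ k + 4 →
    ((H H' : EdgeSet p q) → InΛμ H H' → Canonical H H')
    × ((H H' : EdgeSet p q) → Canonical H H' → InΛμ H H')
    × ((H H' K K' : EdgeSet p q) → InΛμ H H' → InΛμ K K' →
        Σ (Aut p q) λ a → MapsTo a H K × MapsTo a H' K')
    × LambdaIs p q (k + 8)
    × MuIs p q (k + 4)
lemma3p3 k p q 2≤p 2≤q p+q≡k+4 with Spanner.canonical-exists 2≤p 2≤q
... | _ , _ , can₀ =
    (λ _ _ → Λμ⇒canonical can₀)
  , (λ _ _ → canonical⇒Λμ)
  , (λ _ _ _ _ Λμ Λμ' → canonical-aut (Λμ⇒canonical can₀ Λμ) (Λμ⇒canonical can₀ Λμ'))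
  , subst (LambdaIs p q) (trans (cong (_+ 4) p+q≡k+4) (+-assoc k 4 4)) (λ-value can₀)
  , subst (MuIs p q) p+q≡k+4 (μ-value can₀)
  where open Spanner {p} {q}
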